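{- Let $X=\{x_{1},\ldots,x_{l}\}$ and $Y=\{ -y_{1},\ldots,-y_{m}\}$ be disjoint nonempty sets of even integers, where $x_{1}>\cdots>x_{l}$ are non-negative even integers and $y_{1}<\cdots<y_{m}$ are positive even integers, and suppose $X\cup Y\neq\{0\}$. Let $L=\sum_{i=1}^{l}x_{i}$, $M=\sum_{i=1}^{m}y_{i}$ and $n=lM+mL$. Let $-Y=\{y:-y\in Y\}$. If $k=p+q$ is the minimum odd number such that there exist a sequence of $p\ge 1$ (not necessarily distinct) elements of $X$ and a sequence of $q\ge 1$ (not necessarily distinct) elements of $-Y$ having the same sum, then $k<n$. -}

module Defs where

open import Data.Nat using (ℕ; _+_; _*_; _≤_; _<_; _>_)
open import Data.Nat.Divisibility using (_∣_)
open import Data.List using (List; length)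
open import Data.Nat.ListAction using (sum)
open import Data.List.Relation.Unary.All using (All)
open import Data.List.Membership.Propositional using (_∈_)
open import Data.Product using (∃₂; _×_)
open import Relation.Nullary using (¬_)
open import Relation.Binary.PropositionalEquality using (_≡_)

Odd : ℕ → Set
Odd k = ¬ (2 ∣ k)

-- xs lists the elements x₁,…,x_l of X; ys lists y₁,…,y_m where Y = {-y₁,…,-y_m},
-- so ys lists the elements of -Y.
Rep : List ℕ → List ℕ → ℕ → Set
Rep xs ys k =
  ∃₂ λ (as bs : List ℕ) →
    (1 ≤ length as) × (1 ≤ length bs) ×
    All (_∈ xs) as × All (_∈ ys) bs ×
    (sum as ≡ sum bs) × (length as + length bs ≡ k)

IsMinOddRep : List ℕ → List ℕ → ℕ → Set
IsMinOddRep xs ys k =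
  Odd k × Rep xs ys k × (∀ k′ → Odd k′ → Rep xs ys k′ → k ≤ k′)

nOf : List ℕ → List ℕ → ℕ
nOf xs ys = length xs * sum ys + length ys * sum xs

-- All elements are even, so halving them reduces the claim to k < 2 (L + M) for the halved
-- sets (and n doubles). If a representation uses the summand 0, then y copies of x against
-- x copies of y, padded by one 0 if x + y is even, give an odd representation of length at
-- most x + y + 1. Otherwise interleave the two sequences greedily so that every partial
-- imbalance lies in (−M, L]; if k > L + M, two of the first L + M + 1 prefixes have the same
-- imbalance, which cuts the representation into two shorter balanced pieces, one of them of
-- odd length, contradicting minimality. Hence k ≤ L + M.

module Submission where

open import Defs
open import Data.Nat using (ℕ; zero; suc; _+_; _*_; _∸_; _≤_; _<_; _>_; z≤n; s≤s; s≤s⁻¹; _⊓_; NonZero; _≤ᵇ_)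
open import Data.Nat.Properties
open import Data.Nat.Divisibility using (_∣_; divides; _∣?_; ∣m∣n⇒∣m+n; ∣m+n∣m⇒∣n)
open import Data.Nat.ListAction using (sum)
open import Data.Nat.ListAction.Properties using (sum-++)
open import Data.Nat.Tactic.RingSolver using (solve-∀)
open import Data.List using (List; []; _∷_; _++_; length; map; take; drop; replicate)
open import Data.List.Properties using (length-map; length-++; length-take; length-drop; length-replicate; length-++-≤ʳ; take-take; take++drop≡id; ++-assoc)
open import Data.List.Relation.Unary.All using (All; []; _∷_)
import Data.List.Relation.Unary.All as All
open import Data.List.Relation.Unary.All.Properties using (++⁺; ++⁻; ¬Any⇒All¬; map⁺; map⁻; replicate⁺)
open import Data.List.Relation.Unary.Any using (here; there)
open import Data.List.Relation.Unary.Linked using (Linked)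
open import Data.List.Membership.Propositional using (_∈_)
open import Data.List.Membership.Propositional.Properties using (∈-map⁺; ∈-map⁻)
open import Data.List.Membership.DecPropositional _≟_ using (_∈?_)
open import Data.List.Relation.Binary.Permutation.Propositional using (_↭_; ↭-sym)
open import Data.List.Relation.Binary.Permutation.Propositional.Properties using (shifts; All-resp-↭; ↭-length)
open import Data.Fin using (Fin; toℕ; fromℕ<)
open import Data.Fin.Properties using (pigeonhole; toℕ-fromℕ<; toℕ<n)
open import Data.Sum using (_⊎_; inj₁; inj₂; [_,_])
open import Data.Product using (∃; ∃₂; _×_; _,_; proj₁; proj₂)
open import Data.Empty using (⊥; ⊥-elim)
open import Function using (_∘_)
open import Relation.Nullary using (¬_; Dec; yes; no)
open import Relation.Nullary.Reflects using (Reflects; ofʸ; ofⁿ)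
open import Data.Bool using (if_then_else_)
open import Relation.Binary.PropositionalEquality using (_≡_; refl; sym; trans; cong; cong₂; subst; subst₂; module ≡-Reasoning)

odd-summand : ∀ {m n} → Odd (m + n) → Odd m ⊎ Odd n
odd-summand {m} odd with 2 ∣? m
... | yes 2∣m = inj₂ λ 2∣n → odd (∣m∣n⇒∣m+n 2∣m 2∣n)
... | no  m-odd = inj₁ m-odd

odd-suc : ∀ {n} → 2 ∣ n → Odd (suc n)
odd-suc {n} 2∣n 2∣1+n with ∣m+n∣m⇒∣n (subst (2 ∣_) (+-comm 1 n) 2∣1+n) 2∣n
... | divides zero ()
... | divides (suc q) ()

m<n⇒m+n<2*n : ∀ {m n} → m < n → m + n < 2 * n
m<n⇒m+n<2*n {m} {n} m<n = subst (m + n <_) (cong (n +_) (sym (+-identityʳ n))) (+-monoˡ-< n m<n)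

0<2*n⇒0<n : ∀ {n} → 0 < 2 * n → 0 < n
0<2*n⇒0<n {suc _} _ = s≤s z≤n

∸≡∸⇒+≡+ : ∀ {m n m′ n′} → n ≤ m → n′ ≤ m′ → m ∸ n ≡ m′ ∸ n′ → m + n′ ≡ m′ + n
∸≡∸⇒+≡+ {m} {n} {m′} {n′} n≤m n′≤m′ eq = begin
  m + n′             ≡⟨ cong (_+ n′) (m∸n+n≡m n≤m) ⟨
  m ∸ n + n + n′     ≡⟨ cong (λ t → t + n + n′) eq ⟩
  m′ ∸ n′ + n + n′   ≡⟨ +-assoc (m′ ∸ n′) n n′ ⟩
  m′ ∸ n′ + (n + n′) ≡⟨ cong (m′ ∸ n′ +_) (+-comm n n′) ⟩
  m′ ∸ n′ + (n′ + n) ≡⟨ +-assoc (m′ ∸ n′) n′ n ⟨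
  m′ ∸ n′ + n′ + n   ≡⟨ cong (_+ n) (m∸n+n≡m n′≤m′) ⟩
  m′ + n             ∎
  where open ≡-Reasoning

∈⇒≤sum : ∀ {n ns} → n ∈ ns → n ≤ sum ns
∈⇒≤sum {ns = m ∷ ns} (here refl) = m≤m+n m (sum ns)
∈⇒≤sum {ns = m ∷ ns} (there n∈ns) = ≤-trans (∈⇒≤sum n∈ns) (m≤n+m (sum ns) m)

∈⇒0<length : ∀ {n : ℕ} {ns} → n ∈ ns → 0 < length ns
∈⇒0<length {ns = _ ∷ _} _ = s≤s z≤n

positive-sum : ∀ {ns} → All (0 <_) ns → 0 < length ns → 0 < sum ns
positive-sum {n ∷ ns} (0<n ∷ _) _ = ≤-trans 0<n (m≤m+n n (sum ns))

positive-member : ∀ ns → 0 < sum ns → ∃ λ n → n ∈ ns × 0 < n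
positive-member (zero ∷ ns) 0<Σ with positive-member ns 0<Σ
... | n , n∈ns , 0<n = n , there n∈ns , 0<n
positive-member (suc n ∷ ns) _ = suc n , here refl , s≤s z≤n

sum-replicate : ∀ m n → sum (replicate m n) ≡ m * n
sum-replicate zero    n = refl
sum-replicate (suc m) n = cong (n +_) (sum-replicate m n)

*-distribˡ-sum : ∀ d ns → d * sum ns ≡ sum (map (d *_) ns)
*-distribˡ-sum d []       = *-zeroʳ d
*-distribˡ-sum d (n ∷ ns) = trans (*-distribˡ-+ d n (sum ns)) (cong (d * n +_) (*-distribˡ-sum d ns))

All-∈-map⁻ : ∀ (f : ℕ → ℕ) {ns ms} → All (_∈ map f ns) ms → ∃ λ ks → All (_∈ ns) ks × map f ks ≡ ms
All-∈-map⁻ f []           = [] , [] , refl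
All-∈-map⁻ f (m∈fns ∷ ms) with ∈-map⁻ f m∈fns | All-∈-map⁻ f ms
... | k , k∈ns , refl | ks , ks⊆ns , refl = k ∷ ks , k∈ns ∷ ks⊆ns , refl

-- A walk interleaves summands from X (inj₁) with summands from −Y (inj₂).
Step : Set
Step = ℕ ⊎ ℕ

Walk : Set
Walk = List Step

lefts : Walk → List ℕ
lefts []           = []
lefts (inj₁ a ∷ w) = a ∷ lefts w
lefts (inj₂ _ ∷ w) = lefts w

rights : Walk → List ℕ
rights []           = []
rights (inj₁ _ ∷ w) = rights w
rights (inj₂ b ∷ w) = b ∷ rights w

Σˡ Σʳ : Walk → ℕ
Σˡ w = sum (lefts w)
Σʳ w = sum (rights w)

Balanced : Walk → Set
Balanced w = Σˡ w ≡ Σʳ w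

length-lefts+rights : ∀ w → length (lefts w) + length (rights w) ≡ length w
length-lefts+rights []           = refl
length-lefts+rights (inj₁ _ ∷ w) = cong suc (length-lefts+rights w)
length-lefts+rights (inj₂ _ ∷ w) = trans (+-suc (length (lefts w)) (length (rights w))) (cong suc (length-lefts+rights w))

lefts-++ : ∀ u v → lefts (u ++ v) ≡ lefts u ++ lefts v
lefts-++ []           v = refl
lefts-++ (inj₁ a ∷ u) v = cong (a ∷_) (lefts-++ u v)
lefts-++ (inj₂ _ ∷ u) v = lefts-++ u v

rights-++ : ∀ u v → rights (u ++ v) ≡ rights u ++ rights v
rights-++ []           v = refl
rights-++ (inj₁ _ ∷ u) v = rights-++ u v
rights-++ (inj₂ b ∷ u) v = cong (b ∷_) (rights-++ u v)

Σˡ-++ : ∀ u v → Σˡ (u ++ v) ≡ Σˡ u + Σˡ v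
Σˡ-++ u v = trans (cong sum (lefts-++ u v)) (sum-++ (lefts u) (lefts v))

Σʳ-++ : ∀ u v → Σʳ (u ++ v) ≡ Σʳ u + Σʳ v
Σʳ-++ u v = trans (cong sum (rights-++ u v)) (sum-++ (rights u) (rights v))

module _ {P : Step → Set} where

  All-lefts : ∀ {w} → All P w → All (λ a → P (inj₁ a)) (lefts w)
  All-lefts {[]}         []       = []
  All-lefts {inj₁ _ ∷ _} (p ∷ ps) = p ∷ All-lefts ps
  All-lefts {inj₂ _ ∷ _} (_ ∷ ps) = All-lefts ps

  All-rights : ∀ {w} → All P w → All (λ b → P (inj₂ b)) (rights w)
  All-rights {[]}         []       = []
  All-rights {inj₁ _ ∷ _} (_ ∷ ps) = All-rights ps
  All-rights {inj₂ _ ∷ _} (p ∷ ps) = p ∷ All-rights ps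

  All-sides : ∀ w → All (λ a → P (inj₁ a)) (lefts w) → All (λ b → P (inj₂ b)) (rights w) → All P w
  All-sides []           _        _        = []
  All-sides (inj₁ _ ∷ w) (p ∷ ps) qs       = p ∷ All-sides w ps qs
  All-sides (inj₂ _ ∷ w) ps       (q ∷ qs) = q ∷ All-sides w ps qs

balanced-gap : ∀ u v → Σˡ u + Σʳ (u ++ v) ≡ Σˡ (u ++ v) + Σʳ u → Balanced v
balanced-gap u v eq = sym (+-cancelˡ-≡ (Σˡ u + Σʳ u) (Σʳ v) (Σˡ v) (begin
  Σˡ u + Σʳ u + Σʳ v   ≡⟨ +-assoc (Σˡ u) (Σʳ u) (Σʳ v) ⟩
  Σˡ u + (Σʳ u + Σʳ v) ≡⟨ cong (Σˡ u +_) (Σʳ-++ u v) ⟨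
  Σˡ u + Σʳ (u ++ v)   ≡⟨ eq ⟩
  Σˡ (u ++ v) + Σʳ u   ≡⟨ cong (_+ Σʳ u) (Σˡ-++ u v) ⟩
  Σˡ u + Σˡ v + Σʳ u   ≡⟨ swap (Σˡ u) (Σˡ v) (Σʳ u) ⟩
  Σˡ u + Σʳ u + Σˡ v   ∎))
  where
  open ≡-Reasoning
  swap : ∀ a b c → a + b + c ≡ a + c + b
  swap = solve-∀

balanced-outer : ∀ u v t → Balanced (u ++ (v ++ t)) → Balanced v → Balanced (u ++ t)
balanced-outer u v t bal bal-v = +-cancelʳ-≡ (Σʳ v) (Σˡ (u ++ t)) (Σʳ (u ++ t)) (begin
  Σˡ (u ++ t) + Σʳ v          ≡⟨ cong (_+ Σʳ v) (Σˡ-++ u t) ⟩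
  Σˡ u + Σˡ t + Σʳ v          ≡⟨ cong (Σˡ u + Σˡ t +_) bal-v ⟨
  Σˡ u + Σˡ t + Σˡ v          ≡⟨ middle (Σˡ u) (Σˡ t) (Σˡ v) ⟩
  Σˡ u + (Σˡ v + Σˡ t)        ≡⟨ trans (Σˡ-++ u (v ++ t)) (cong (Σˡ u +_) (Σˡ-++ v t)) ⟨
  Σˡ (u ++ (v ++ t))          ≡⟨ bal ⟩
  Σʳ (u ++ (v ++ t))          ≡⟨ trans (Σʳ-++ u (v ++ t)) (cong (Σʳ u +_) (Σʳ-++ v t)) ⟩
  Σʳ u + (Σʳ v + Σʳ t)        ≡⟨ middle (Σʳ u) (Σʳ t) (Σʳ v) ⟨
  Σʳ u + Σʳ t + Σʳ v          ≡⟨ cong (_+ Σʳ v) (Σʳ-++ u t) ⟨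
  Σʳ (u ++ t) + Σʳ v          ∎)
  where
  open ≡-Reasoning
  middle : ∀ a c b → a + c + b ≡ a + (b + c)
  middle = solve-∀

record Window (A B sa sb : ℕ) : Set where
  constructor window
  field
    below : sb < sa + B
    above : sa ≤ sb + A

Window-stepˡ : ∀ {A B sa sb a} → Window A B sa sb → sa + a ≤ sb + A → Window A B (sa + a) sb
Window-stepˡ {B = B} {sa} {a = a} (window below _) bound = window (≤-trans below (+-monoˡ-≤ B (m≤m+n sa a))) bound

Window-stepʳ : ∀ {A B sa sb b} → Window A B sa sb → sb + b < sa + B → Window A B sa (sb + b)
Window-stepʳ {A} {sb = sb} {b} (window _ above) bound = window bound (≤-trans above (+-monoˡ-≤ A (m≤m+n sb b)))

-- Encodes the imbalance sa − sb ∈ (−B, A] as sb + A ∸ sa ∈ [0, A + B).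
imbalance : ∀ {A B sa sb} → Window A B sa sb → Fin (A + B)
imbalance {A} {B} {sa} {sb} (window below above) = fromℕ< (+-cancelʳ-< sa (sb + A ∸ sa) (A + B) (begin-strict
  sb + A ∸ sa + sa ≡⟨ m∸n+n≡m above ⟩
  sb + A           <⟨ +-monoˡ-< A below ⟩
  sa + B + A       ≡⟨ rearrange sa B A ⟩
  A + B + sa       ∎))
  where
  open ≤-Reasoning
  rearrange : ∀ sa B A → sa + B + A ≡ A + B + sa
  rearrange = solve-∀

imbalance-injective : ∀ {A B sa sb sa′ sb′} (p : Window A B sa sb) (q : Window A B sa′ sb′) →
  imbalance p ≡ imbalance q → sa + sb′ ≡ sa′ + sb
imbalance-injective {A} {B} {sa} {sb} {sa′} {sb′} p q eq = +-cancelˡ-≡ A (sa + sb′) (sa′ + sb) (begin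
  A + (sa + sb′) ≡⟨ rearrange A sa sb′ ⟩
  sb′ + A + sa   ≡⟨ ∸≡∸⇒+≡+ (Window.above q) (Window.above p) values ⟩
  sb + A + sa′   ≡⟨ rearrange A sa′ sb ⟨
  A + (sa′ + sb) ∎)
  where
  open ≡-Reasoning
  rearrange : ∀ A s t → A + (s + t) ≡ t + A + s
  rearrange = solve-∀
  values : sb′ + A ∸ sa′ ≡ sb + A ∸ sa
  values = trans (sym (toℕ-fromℕ< _)) (trans (cong toℕ (sym eq)) (toℕ-fromℕ< _))

WindowedFrom : ℕ → ℕ → ℕ → ℕ → Walk → Set
WindowedFrom A B sa sb w = ∀ i → Window A B (Σˡ (take i w) + sa) (Σʳ (take i w) + sb)

Windowed : ℕ → ℕ → Walk → Set
Windowed A B w = ∀ i → Window A B (Σˡ (take i w)) (Σʳ (take i w))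

Windowed-from-origin : ∀ {A B w} → WindowedFrom A B 0 0 w → Windowed A B w
Windowed-from-origin {A} {B} win i = subst₂ (Window A B) (+-identityʳ _) (+-identityʳ _) (win i)

WindowedFrom-∷ˡ : ∀ {A B sa sb a w} → Window A B sa sb → WindowedFrom A B (sa + a) sb w →
  WindowedFrom A B sa sb (inj₁ a ∷ w)
WindowedFrom-∷ˡ here-ok _ zero = here-ok
WindowedFrom-∷ˡ {A} {B} {sa} {sb} {a} {w} _ later (suc i) =
  subst (λ s → Window A B s (Σʳ (take i w) + sb)) (shift (Σˡ (take i w)) sa a) (later i)
  where
  shift : ∀ t s a → t + (s + a) ≡ a + t + s
  shift = solve-∀

WindowedFrom-∷ʳ : ∀ {A B sa sb b w} → Window A B sa sb → WindowedFrom A B sa (sb + b) w →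
  WindowedFrom A B sa sb (inj₂ b ∷ w)
WindowedFrom-∷ʳ here-ok _ zero = here-ok
WindowedFrom-∷ʳ {A} {B} {sa} {sb} {b} {w} _ later (suc i) =
  subst (Window A B (Σˡ (take i w) + sa)) (shift (Σʳ (take i w)) sb b) (later i)
  where
  shift : ∀ t s b → t + (s + b) ≡ b + t + s
  shift = solve-∀

if-reflects : ∀ {Q : Set} (P : Walk → Set) {b x y} → Reflects Q b → (Q → P x) → (¬ Q → P y) →
  P (if b then x else y)
if-reflects P (ofʸ q)  then-case _         = then-case q
if-reflects P (ofⁿ ¬q) _         else-case = else-case ¬q

-- sa and sb are the sums of the parts already merged.
interleave : ℕ → ℕ → List ℕ → List ℕ → Walk
interleave sa sb []       []       = []
interleave sa sb (a ∷ as) []       = inj₁ a ∷ interleave (sa + a) sb as []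
interleave sa sb []       (b ∷ bs) = inj₂ b ∷ interleave sa (sb + b) [] bs
interleave sa sb (a ∷ as) (b ∷ bs) =
  if sa ≤ᵇ sb
  then inj₁ a ∷ interleave (sa + a) sb as (b ∷ bs)
  else inj₂ b ∷ interleave sa (sb + b) (a ∷ as) bs

lefts-interleave : ∀ sa sb as bs → lefts (interleave sa sb as bs) ≡ as
lefts-interleave sa sb []       []       = refl
lefts-interleave sa sb (a ∷ as) []       = cong (a ∷_) (lefts-interleave (sa + a) sb as [])
lefts-interleave sa sb []       (b ∷ bs) = lefts-interleave sa (sb + b) [] bs
lefts-interleave sa sb (a ∷ as) (b ∷ bs) = if-reflects (λ w → lefts w ≡ a ∷ as) (≤ᵇ-reflects-≤ sa sb)
  (λ _ → cong (a ∷_) (lefts-interleave (sa + a) sb as (b ∷ bs)))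
  (λ _ → lefts-interleave sa (sb + b) (a ∷ as) bs)

rights-interleave : ∀ sa sb as bs → rights (interleave sa sb as bs) ≡ bs
rights-interleave sa sb []       []       = refl
rights-interleave sa sb (a ∷ as) []       = rights-interleave (sa + a) sb as []
rights-interleave sa sb []       (b ∷ bs) = cong (b ∷_) (rights-interleave sa (sb + b) [] bs)
rights-interleave sa sb (a ∷ as) (b ∷ bs) = if-reflects (λ w → rights w ≡ b ∷ bs) (≤ᵇ-reflects-≤ sa sb)
  (λ _ → rights-interleave (sa + a) sb as (b ∷ bs))
  (λ _ → cong (b ∷_) (rights-interleave sa (sb + b) (a ∷ as) bs))

-- The totals are equal, so once one list is exhausted the other only closes the gap.
interleave-windowed : ∀ {A B} sa sb as bs → 0 < B → All (_≤ A) as → All (_≤ B) bs →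
  sa + sum as ≡ sb + sum bs → Window A B sa sb → WindowedFrom A B sa sb (interleave sa sb as bs)
interleave-windowed sa sb [] [] _ _ _ _ win zero    = win
interleave-windowed sa sb [] [] _ _ _ _ win (suc _) = win
interleave-windowed {A} sa sb (a ∷ as) [] 0<B (_ ∷ as≤A) [] total win =
  WindowedFrom-∷ˡ win (interleave-windowed (sa + a) sb as [] 0<B as≤A [] (trans (+-assoc sa a _) total)
    (Window-stepˡ win (begin
      sa + a            ≤⟨ +-monoʳ-≤ sa (m≤m+n a (sum as)) ⟩
      sa + (a + sum as) ≡⟨ trans total (+-identityʳ sb) ⟩
      sb                ≤⟨ m≤m+n sb A ⟩
      sb + A            ∎)))
  where open ≤-Reasoning
interleave-windowed {B = B} sa sb [] (b ∷ bs) 0<B [] (_ ∷ bs≤B) total win =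
  WindowedFrom-∷ʳ win (interleave-windowed sa (sb + b) [] bs 0<B [] bs≤B (trans total (sym (+-assoc sb b _)))
    (Window-stepʳ win (begin-strict
      sb + b            ≤⟨ +-monoʳ-≤ sb (m≤m+n b (sum bs)) ⟩
      sb + (b + sum bs) ≡⟨ trans (sym (+-identityʳ sa)) total ⟨
      sa                <⟨ m<m+n sa 0<B ⟩
      sa + B            ∎)))
  where open ≤-Reasoning
interleave-windowed {A} {B} sa sb (a ∷ as) (b ∷ bs) 0<B (a≤A ∷ as≤A) (b≤B ∷ bs≤B) total win =
  if-reflects (WindowedFrom A B sa sb) (≤ᵇ-reflects-≤ sa sb)
    (λ sa≤sb → WindowedFrom-∷ˡ win (interleave-windowed (sa + a) sb as (b ∷ bs) 0<B as≤A (b≤B ∷ bs≤B)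
                 (trans (+-assoc sa a _) total) (Window-stepˡ win (+-mono-≤ sa≤sb a≤A))))
    (λ sa≰sb → WindowedFrom-∷ʳ win (interleave-windowed sa (sb + b) (a ∷ as) bs 0<B (a≤A ∷ as≤A) bs≤B
                 (trans total (sym (+-assoc sb b _))) (Window-stepʳ win (+-mono-<-≤ (≰⇒> sa≰sb) b≤B))))

balanced-cut : ∀ w {i j} → i < j → j < length w → Balanced w →
  Σˡ (take i w) + Σʳ (take j w) ≡ Σˡ (take j w) + Σʳ (take i w) →
  ∃₂ λ u v → u ++ v ↭ w × Balanced u × Balanced v × 0 < length u × 0 < length v
balanced-cut w {i} {j} i<j j<|w| bal same-gap =
  M , P ++ R , perm , bal-M , balanced-outer P M R (subst Balanced w≡PMR bal) bal-M , 0<|M| , 0<|PR|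
  where
  P M R : Walk
  P = take i w
  M = drop i (take j w)
  R = drop j w
  take-j : take j w ≡ P ++ M
  take-j = begin
    take j w                   ≡⟨ take++drop≡id i (take j w) ⟨
    take i (take j w) ++ M     ≡⟨ cong (_++ M) (take-take i j w) ⟩
    take (i ⊓ j) w ++ M        ≡⟨ cong (λ n → take n w ++ M) (m≤n⇒m⊓n≡m (<⇒≤ i<j)) ⟩
    P ++ M                     ∎
    where open ≡-Reasoning
  w≡PMR : w ≡ P ++ (M ++ R)
  w≡PMR = trans (sym (take++drop≡id j w)) (trans (cong (_++ R) take-j) (++-assoc P M R))
  perm : M ++ (P ++ R) ↭ w
  perm = subst (M ++ (P ++ R) ↭_) (sym w≡PMR) (shifts M P)
  bal-M : Balanced M
  bal-M = balanced-gap P M (subst (λ t → Σˡ P + Σʳ t ≡ Σˡ t + Σʳ P) take-j same-gap)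
  0<|M| : 0 < length M
  0<|M| = subst (0 <_) (sym (trans (length-drop i (take j w))
            (cong (_∸ i) (trans (length-take j w) (m≤n⇒m⊓n≡m (<⇒≤ j<|w|)))))) (m<n⇒0<n∸m i<j)
  0<|PR| : 0 < length (P ++ R)
  0<|PR| = ≤-trans (subst (0 <_) (sym (length-drop j w)) (m<n⇒0<n∸m j<|w|)) (length-++-≤ʳ R {P})

-- Pigeonhole: among the first A + B + 1 prefixes two have the same imbalance.
windowed-split : ∀ {A B} w → Windowed A B w → Balanced w → A + B < length w →
  ∃₂ λ u v → u ++ v ↭ w × Balanced u × Balanced v × 0 < length u × 0 < length v
windowed-split {A} {B} w win bal A+B<|w|
  with i , j , i<j , same-imbalance ← pigeonhole (n<1+n (A + B)) (λ i → imbalance (win (toℕ i)))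
  = balanced-cut w i<j (≤-<-trans (s≤s⁻¹ (toℕ<n j)) A+B<|w|) bal
      (imbalance-injective (win (toℕ i)) (win (toℕ j)) same-imbalance)

Summand : List ℕ → List ℕ → Step → Set
Summand xs ys (inj₁ a) = a ∈ xs × 0 < a
Summand xs ys (inj₂ b) = b ∈ ys × 0 < b

balanced-sides : ∀ l r → All (0 <_) l → All (0 <_) r → sum l ≡ sum r → 0 < length l + length r →
  0 < length l × 0 < length r
balanced-sides []      (_ ∷ _) _     0<r Σ≡ _ = ⊥-elim (<⇒≢ (positive-sum 0<r (s≤s z≤n)) Σ≡)
balanced-sides (_ ∷ _) []      0<l _   Σ≡ _ = ⊥-elim (<⇒≢ (positive-sum 0<l (s≤s z≤n)) (sym Σ≡))
balanced-sides (_ ∷ _) (_ ∷ _) _   _   _  _ = s≤s z≤n , s≤s z≤n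

walk⇒Rep : ∀ {xs ys} w → All (Summand xs ys) w → Balanced w → 0 < length w → Rep xs ys (length w)
walk⇒Rep {xs} {ys} w summands bal 0<|w| =
  lefts w , rights w , proj₁ sides , proj₂ sides ,
  All.map proj₁ left-summands , All.map proj₁ right-summands , bal , length-lefts+rights w
  where
  left-summands : All (λ a → a ∈ xs × 0 < a) (lefts w)
  left-summands = All-lefts summands
  right-summands : All (λ b → b ∈ ys × 0 < b) (rights w)
  right-summands = All-rights summands
  sides : 0 < length (lefts w) × 0 < length (rights w)
  sides = balanced-sides (lefts w) (rights w) (All.map proj₂ left-summands) (All.map proj₂ right-summands)
            bal (subst (0 <_) (sym (length-lefts+rights w)) 0<|w|)

-- Of the two balanced pieces one has odd length, and it is shorter than the walk.
windowed-minOddRep≤ : ∀ {xs ys A B} w → Windowed A B w → All (Summand xs ys) w → Balanced w →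
  IsMinOddRep xs ys (length w) → length w ≤ A + B
windowed-minOddRep≤ {xs} {ys} {A} {B} w win summands bal (odd , _ , minimal) =
  ≮⇒≥ (λ A+B<|w| → pieces⇒⊥ (windowed-split w win bal A+B<|w|))
  where
  piece-even : ∀ {t} → All (Summand xs ys) t → Balanced t → 0 < length t → length t < length w →
    ¬ Odd (length t)
  piece-even {t} summands-t bal-t 0<|t| |t|<|w| odd-t =
    <⇒≱ |t|<|w| (minimal (length t) odd-t (walk⇒Rep t summands-t bal-t 0<|t|))

  pieces⇒⊥ : (∃₂ λ u v → u ++ v ↭ w × Balanced u × Balanced v × 0 < length u × 0 < length v) → ⊥
  pieces⇒⊥ (u , v , perm , bal-u , bal-v , 0<|u| , 0<|v|) =
    [ piece-even summands-u bal-u 0<|u| |u|<|w| , piece-even summands-v bal-v 0<|v| |v|<|w| ]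
      (odd-summand (subst Odd (sym |u|+|v|≡|w|) odd))
    where
    |u|+|v|≡|w| : length u + length v ≡ length w
    |u|+|v|≡|w| = trans (sym (length-++ u)) (↭-length perm)
    summands-u : All (Summand xs ys) u
    summands-u = proj₁ (++⁻ u (All-resp-↭ (↭-sym perm) summands))
    summands-v : All (Summand xs ys) v
    summands-v = proj₂ (++⁻ u (All-resp-↭ (↭-sym perm) summands))
    |u|<|w| : length u < length w
    |u|<|w| = subst (length u <_) |u|+|v|≡|w| (m<m+n (length u) 0<|v|)
    |v|<|w| : length v < length w
    |v|<|w| = subst (length v <_) (trans (+-comm (length v) (length u)) |u|+|v|≡|w|) (m<m+n (length v) 0<|u|)

minOddRep≤sum+sum : ∀ {xs ys} as bs → All (_∈ xs) as → All (_∈ ys) bs → All (0 <_) as → All (0 <_) bs →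
  0 < sum ys → sum as ≡ sum bs → IsMinOddRep xs ys (length as + length bs) →
  length as + length bs ≤ sum xs + sum ys
minOddRep≤sum+sum {xs} {ys} as bs as⊆xs bs⊆ys 0<as 0<bs 0<Σys Σ≡ isMin =
  subst (_≤ sum xs + sum ys) |w|≡
    (windowed-minOddRep≤ w windowed summands balanced (subst (IsMinOddRep xs ys) (sym |w|≡) isMin))
  where
  w : Walk
  w = interleave 0 0 as bs
  lefts-w : lefts w ≡ as
  lefts-w = lefts-interleave 0 0 as bs
  rights-w : rights w ≡ bs
  rights-w = rights-interleave 0 0 as bs
  |w|≡ : length w ≡ length as + length bs
  |w|≡ = trans (sym (length-lefts+rights w)) (cong₂ _+_ (cong length lefts-w) (cong length rights-w))
  windowed : Windowed (sum xs) (sum ys) w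
  windowed = Windowed-from-origin (interleave-windowed 0 0 as bs 0<Σys (All.map ∈⇒≤sum as⊆xs)
               (All.map ∈⇒≤sum bs⊆ys) Σ≡ (window 0<Σys z≤n))
  summands : All (Summand xs ys) w
  summands = All-sides w (subst (All _) (sym lefts-w) (All.zip (as⊆xs , 0<as)))
               (subst (All _) (sym rights-w) (All.zip (bs⊆ys , 0<bs)))
  balanced : Balanced w
  balanced = trans (cong sum lefts-w) (trans Σ≡ (sym (cong sum rights-w)))

-- y copies of x balance x copies of y; a zero summand fixes the parity if needed.
odd-rep-with-zero : ∀ {xs ys x y} → 0 ∈ xs → x ∈ xs → y ∈ ys → 0 < x → 0 < y →
  ∃ λ k → Odd k × Rep xs ys k × k ≤ suc (y + x)
odd-rep-with-zero {xs} {ys} {x} {y} 0∈xs x∈xs y∈ys 0<x 0<y = by-parity (2 ∣? (y + x))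
  where
  copies : ∀ zeros → All (_∈ xs) zeros → sum zeros ≡ 0 → Rep xs ys (length zeros + (y + x))
  copies zeros zeros⊆xs Σ≡0 =
    zeros ++ replicate y x , replicate x y ,
    ≤-trans (subst (0 <_) (sym (length-replicate y)) 0<y) (length-++-≤ʳ (replicate y x) {zeros}) ,
    subst (0 <_) (sym (length-replicate x)) 0<x ,
    ++⁺ zeros⊆xs (replicate⁺ y x∈xs) , replicate⁺ x y∈ys ,
    Σ≡ , |as|+|bs|≡
    where
    Σ≡ : sum (zeros ++ replicate y x) ≡ sum (replicate x y)
    Σ≡ = begin
      sum (zeros ++ replicate y x)    ≡⟨ sum-++ zeros (replicate y x) ⟩
      sum zeros + sum (replicate y x) ≡⟨ cong₂ _+_ Σ≡0 (sum-replicate y x) ⟩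
      y * x                           ≡⟨ *-comm y x ⟩
      x * y                           ≡⟨ sum-replicate x y ⟨
      sum (replicate x y)             ∎
      where open ≡-Reasoning
    |as|+|bs|≡ : length (zeros ++ replicate y x) + length (replicate x y) ≡ length zeros + (y + x)
    |as|+|bs|≡ = trans (cong₂ _+_ (trans (length-++ zeros) (cong (length zeros +_) (length-replicate y)))
                   (length-replicate x)) (+-assoc (length zeros) y x)

  by-parity : Dec (2 ∣ y + x) → ∃ λ k → Odd k × Rep xs ys k × k ≤ suc (y + x)
  by-parity (no  odd)  = y + x , odd , copies [] [] refl , n≤1+n (y + x)
  by-parity (yes even) = suc (y + x) , odd-suc even , copies (0 ∷ []) (0∈xs ∷ []) refl , ≤-refl

minOddRep<2*sum : ∀ {xs ys k} → All (0 <_) ys → IsMinOddRep xs ys k → k < 2 * (sum xs + sum ys)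
minOddRep<2*sum {xs} {ys} 0<ys isMin@(_ , (as , b ∷ bs , _ , _ , as⊆xs , b∈ys ∷ bs⊆ys , Σ≡ , refl) , minimal) =
  by-zero (0 ∈? as)
  where
  0<b : 0 < b
  0<b = All.lookup 0<ys b∈ys

  b≤Σys : b ≤ sum ys
  b≤Σys = ∈⇒≤sum b∈ys

  by-zero : Dec (0 ∈ as) → length as + suc (length bs) < 2 * (sum xs + sum ys)
  by-zero (no 0∉as) = ≤-<-trans
    (minOddRep≤sum+sum as (b ∷ bs) as⊆xs (b∈ys ∷ bs⊆ys) 0<as (All.map (All.lookup 0<ys) (b∈ys ∷ bs⊆ys))
      (≤-trans 0<b b≤Σys) Σ≡ isMin)
    (m<n⇒m+n<2*n (≤-trans 0<b (≤-trans b≤Σys (m≤n+m (sum ys) (sum xs)))))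
    where
    0<as : All (0 <_) as
    0<as = All.map (λ 0≢a → n≢0⇒n>0 (0≢a ∘ sym)) (¬Any⇒All¬ as 0∉as)
  by-zero (yes 0∈as)
    with x , x∈as , 0<x ← positive-member as (subst (0 <_) (sym Σ≡) (≤-trans 0<b (m≤m+n b (sum bs))))
    with k′ , odd′ , rep′ , k′≤1+b+x ←
           odd-rep-with-zero (All.lookup as⊆xs 0∈as) (All.lookup as⊆xs x∈as) b∈ys 0<x 0<b
    = begin-strict
      length as + suc (length bs) ≤⟨ minimal k′ odd′ rep′ ⟩
      k′                          ≤⟨ k′≤1+b+x ⟩
      suc (b + x)                 <⟨ m<n⇒m+n<2*n (+-mono-≤ 0<b 0<x) ⟩
      2 * (b + x)                 ≡⟨ cong (2 *_) (+-comm b x) ⟩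
      2 * (x + b)                 ≤⟨ *-monoʳ-≤ 2 (+-mono-≤ (∈⇒≤sum (All.lookup as⊆xs x∈as)) b≤Σys) ⟩
      2 * (sum xs + sum ys)       ∎
    where open ≤-Reasoning

sum+sum≤nOf : ∀ xs ys → 0 < length xs → 0 < length ys → sum xs + sum ys ≤ nOf xs ys
sum+sum≤nOf xs@(_ ∷ _) ys@(_ ∷ _) _ _ = begin
  sum xs + sum ys                         ≤⟨ +-mono-≤ (m≤n*m (sum xs) (length ys)) (m≤n*m (sum ys) (length xs)) ⟩
  length ys * sum xs + length xs * sum ys ≡⟨ +-comm (length ys * sum xs) (length xs * sum ys) ⟩
  nOf xs ys                               ∎
  where open ≤-Reasoning

Rep⇒nonempty : ∀ {xs ys k} → Rep xs ys k → 0 < length xs × 0 < length ys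
Rep⇒nonempty (_ ∷ _ , _ ∷ _ , _ , _ , a∈xs ∷ _ , b∈ys ∷ _ , _) = ∈⇒0<length a∈xs , ∈⇒0<length b∈ys

minOddRep<2*nOf : ∀ {xs ys k} → All (0 <_) ys → IsMinOddRep xs ys k → k < 2 * nOf xs ys
minOddRep<2*nOf {xs} {ys} 0<ys isMin@(_ , rep , _) =
  <-≤-trans (minOddRep<2*sum 0<ys isMin) (*-monoʳ-≤ 2 (sum+sum≤nOf xs ys (proj₁ nonempty) (proj₂ nonempty)))
  where
  nonempty : 0 < length xs × 0 < length ys
  nonempty = Rep⇒nonempty rep

Rep-scale : ∀ d {xs ys k} → Rep xs ys k → Rep (map (d *_) xs) (map (d *_) ys) k
Rep-scale d (as , bs , 0<|as| , 0<|bs| , as⊆xs , bs⊆ys , Σ≡ , |as|+|bs|≡k) =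
  map (d *_) as , map (d *_) bs ,
  subst (0 <_) (sym (length-map (d *_) as)) 0<|as| , subst (0 <_) (sym (length-map (d *_) bs)) 0<|bs| ,
  map⁺ (All.map (∈-map⁺ (d *_)) as⊆xs) , map⁺ (All.map (∈-map⁺ (d *_)) bs⊆ys) ,
  trans (sym (*-distribˡ-sum d as)) (trans (cong (d *_) Σ≡) (*-distribˡ-sum d bs)) ,
  trans (cong₂ _+_ (length-map (d *_) as) (length-map (d *_) bs)) |as|+|bs|≡k

Rep-unscale : ∀ d .{{_ : NonZero d}} {xs ys k} → Rep (map (d *_) xs) (map (d *_) ys) k → Rep xs ys k
Rep-unscale d (as , bs , 0<|as| , 0<|bs| , as⊆dxs , bs⊆dys , Σ≡ , |as|+|bs|≡k)
  with as′ , as′⊆xs , refl ← All-∈-map⁻ (d *_) as⊆dxs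
     | bs′ , bs′⊆ys , refl ← All-∈-map⁻ (d *_) bs⊆dys
  = as′ , bs′ ,
    subst (0 <_) (length-map (d *_) as′) 0<|as| , subst (0 <_) (length-map (d *_) bs′) 0<|bs| ,
    as′⊆xs , bs′⊆ys ,
    *-cancelˡ-≡ (sum as′) (sum bs′) d (trans (*-distribˡ-sum d as′) (trans Σ≡ (sym (*-distribˡ-sum d bs′)))) ,
    trans (sym (cong₂ _+_ (length-map (d *_) as′) (length-map (d *_) bs′))) |as|+|bs|≡k

IsMinOddRep-unscale : ∀ d .{{_ : NonZero d}} {xs ys k} →
  IsMinOddRep (map (d *_) xs) (map (d *_) ys) k → IsMinOddRep xs ys k
IsMinOddRep-unscale d (odd , rep , minimal) =
  odd , Rep-unscale d rep , λ k′ odd′ rep′ → minimal k′ odd′ (Rep-scale d rep′)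

nOf-scale : ∀ d xs ys → nOf (map (d *_) xs) (map (d *_) ys) ≡ d * nOf xs ys
nOf-scale d xs ys = begin
  nOf (map (d *_) xs) (map (d *_) ys)
    ≡⟨ cong₂ _+_ (cong₂ _*_ (length-map (d *_) xs) (sym (*-distribˡ-sum d ys)))
                 (cong₂ _*_ (length-map (d *_) ys) (sym (*-distribˡ-sum d xs))) ⟩
  length xs * (d * sum ys) + length ys * (d * sum xs)
    ≡⟨ factor (length xs) (length ys) (sum xs) (sum ys) d ⟩
  d * nOf xs ys
    ∎
  where
  open ≡-Reasoning
  factor : ∀ l m L M d → l * (d * M) + m * (d * L) ≡ d * (l * M + m * L)
  factor = solve-∀

halve : ∀ {ns} → All (2 ∣_) ns → ∃ λ ms → map (2 *_) ms ≡ ns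
halve []                        = [] , refl
halve (divides q refl ∷ evens) with ms , refl ← halve evens = q ∷ ms , cong (_∷ map (2 *_) ms) (*-comm 2 q)

doubled-minOddRep<nOf : ∀ xs ys {k} → All (0 <_) (map (2 *_) ys) →
  IsMinOddRep (map (2 *_) xs) (map (2 *_) ys) k → k < nOf (map (2 *_) xs) (map (2 *_) ys)
doubled-minOddRep<nOf xs ys {k} 0<2ys isMin = subst (k <_) (sym (nOf-scale 2 xs ys))
  (minOddRep<2*nOf (All.map 0<2*n⇒0<n (map⁻ 0<2ys)) (IsMinOddRep-unscale 2 isMin))

theorem4p1 : (x₁ y₁ : ℕ) (xs′ ys′ : List ℕ) →
    All (2 ∣_) (x₁ ∷ xs′) → Linked _>_ (x₁ ∷ xs′) →
    All (2 ∣_) (y₁ ∷ ys′) → All (0 <_) (y₁ ∷ ys′) → Linked _<_ (y₁ ∷ ys′) →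
    (k : ℕ) → IsMinOddRep (x₁ ∷ xs′) (y₁ ∷ ys′) k → k < nOf (x₁ ∷ xs′) (y₁ ∷ ys′)
theorem4p1 x₁ y₁ xs′ ys′ even-xs _ even-ys 0<ys _ k isMin
  with xs , xs≡ ← halve even-xs
     | ys , ys≡ ← halve even-ys
  = subst₂ (λ X Y → All (0 <_) Y → IsMinOddRep X Y k → k < nOf X Y) xs≡ ys≡
      (doubled-minOddRep<nOf xs ys) 0<ys isMin
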